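{- Let $\alpha\ge 1$ and $\beta\ge 1$ be integers, $\ell=\min\{\alpha,\beta\}$ and $u=\max\{\alpha,\beta\}$. Let $g:\mathbb{Z}\to\mathbb{Z}$ be defined by $g(k)=0$ for $k<0$, $g(0)=1$, and $g(k)=g(k-\alpha)+g(k-\beta)$ for $k\ge 1$. Define $G(k)=\sum_{i=1}^{\ell} g(k+1-i)$ for all integers $k$. Then $G$ is an $(\alpha,\beta)$ Fibonacci sequence with initial values $G(k)=0$ for $k<0$ and $G(k)=1$ for $0\le k<u$; that is, $G(k)=0$ for $k<0$, $G(k)=1$ for $0\le k<u$, and $G(k)=G(k-\alpha)+G(k-\beta)$ for all $k\ge u$.
   Context: The sequence $g$ is called the $(\alpha,\beta)$ Fibonacci sequence; an $(\alpha,\beta)$ Fibonacci sequence with given initial values is a sequence satisfying $h(k)=h(k-\alpha)+h(k-\beta)$ beyond its initial values. -}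

module Defs where

open import Data.Nat as ℕ using (ℕ; zero; suc)
open import Data.Integer using (ℤ; +_; -[1+_]; _+_; _-_)

-- Fuel-based evaluation of g.  With fuel f, gFuel f α β k computes g(k)
-- correctly whenever k < f (for α, β ≥ 1), since each recursive call
-- strictly decreases k.
gFuel : ℕ → ℕ → ℕ → ℤ → ℤ
gFuel _       α β -[1+ _ ]    = + 0
gFuel _       α β (+ zero)    = + 1
gFuel zero    α β (+ suc _)   = + 0
gFuel (suc f) α β (+ suc m)   =
  gFuel f α β (+ suc m - + α) + gFuel f α β (+ suc m - + β)

g : ℕ → ℕ → ℤ → ℤ
g α β -[1+ n ] = + 0
g α β (+ n)    = gFuel (suc n) α β (+ n)

sumFrom1 : ℕ → (ℕ → ℤ) → ℤ
sumFrom1 zero    h = + 0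
sumFrom1 (suc n) h = sumFrom1 n h + h (suc n)

G : ℕ → ℕ → ℤ → ℤ
G α β k = sumFrom1 (ℕ._⊓_ α β) (λ i → g α β (k + + 1 - + i))

module Submission where

-- Write W_N f (k) = Σ_{i=1}^{N} f(k+1-i) for the window
-- sum of the last N values of f up to k, so that G = W_ℓ g.  Consecutive
-- windows differ by one entry at each end:
--     W_N f (k+1) + f(k+1-N) = f(k+1) + W_N f (k).
-- (1) For k < 0 every entry of the window is at a negative index, so G(k) = 0.
-- (2) The window identity at k = -1 gives G(0) = g(0) = 1.  For 0 < k < u the
--     index k - u is negative, so the recurrence for g collapses to
--     g(k) = g(k - ℓ); the two ends of the window then agree and G(k) = G(k-1).
-- (3) For k ≥ u every index k+1-i (1 ≤ i ≤ ℓ) is positive, so the recurrence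
--     for g applies to each summand, and the window sum splits accordingly.

open import Defs
open import Data.Nat as ℕ using (ℕ; _⊔_; _⊓_; zero; suc; s≤s)
import Data.Nat.Properties as ℕP
open import Data.Integer using (ℤ; +_; -[1+_]; _+_; _-_; -_; _<_; _≤_; +≤+; +<+; -<+)
import Data.Integer.Properties as ℤP
open import Algebra.Properties.AbelianGroup ℤP.+-0-abelianGroup using (∙-cancelʳ)
open import Data.Integer.Tactic.RingSolver using (solve-∀)
open import Data.Product using (_×_; _,_)
open import Data.Sum using (inj₁; inj₂)
open import Relation.Binary.PropositionalEquality
  using (_≡_; refl; sym; trans; cong; cong₂; subst; module ≡-Reasoning)

sub-suc : ∀ (k i : ℤ) → k + + 1 - (+ 1 + i) ≡ k - i
sub-suc = solve-∀

shifted-below : ∀ (k : ℤ) {i} → 1 ℕ.≤ i → k + + 1 - + i ≤ k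
shifted-below k {suc i} _ = subst (_≤ k) (sym (sub-suc k (+ i))) (ℤP.i-j≤i k (+ i))

shifted-positive : ∀ {k : ℤ} {i} → + i ≤ k → + 0 < k + + 1 - + i
shifted-positive {k} {i} i≤k =
  subst (+ 0 <_) (shift k (+ i)) (ℤP.suc[i]≤j⇒i<j (ℤP.suc-mono (ℤP.i≤j⇒0≤j-i i≤k)))
  where
    shift : ∀ (k i : ℤ) → + 1 + (k - i) ≡ k + + 1 - i
    shift = solve-∀

sub-larger-negative : ∀ {i j : ℤ} → i < j → i - j < + 0
sub-larger-negative {i} {j} i<j =
  subst (i - j <_) (ℤP.+-inverseʳ j) (ℤP.+-monoˡ-< (- j) i<j)

module Sequence (α β : ℕ) (1≤α : 1 ℕ.≤ α) (1≤β : 1 ℕ.≤ β) where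

  recursive-call-below : ∀ {m f a} → 1 ℕ.≤ a → m ℕ.< f → + suc m - + a < + f
  recursive-call-below {m} {f} {a} 1≤a m<f =
    subst (λ x → x - + a < + f) (cong +_ (ℕP.+-comm m 1))
          (ℤP.≤-<-trans (shifted-below (+ m) 1≤a) (+<+ m<f))

  fuel-irrelevant : ∀ f f' k → k < + f → k < + f' → gFuel f α β k ≡ gFuel f' α β k
  fuel-irrelevant _ _ -[1+ _ ] _ _ = refl
  fuel-irrelevant _ _ (+ zero) _ _ = refl
  fuel-irrelevant zero _ (+ suc _) (+<+ ()) _
  fuel-irrelevant (suc _) zero (+ suc _) _ (+<+ ())
  fuel-irrelevant (suc f) (suc f') (+ suc m) (+<+ (s≤s m<f)) (+<+ (s≤s m<f')) =
    cong₂ _+_ (fuel-irrelevant f f' _ (recursive-call-below 1≤α m<f) (recursive-call-below 1≤α m<f'))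
              (fuel-irrelevant f f' _ (recursive-call-below 1≤β m<f) (recursive-call-below 1≤β m<f'))

  fuel-sufficient : ∀ f k → k < + f → gFuel f α β k ≡ g α β k
  fuel-sufficient f -[1+ _ ] _ = refl
  fuel-sufficient f (+ n) n<f = fuel-irrelevant f (suc n) (+ n) n<f (+<+ ℕP.≤-refl)

  g-negative : ∀ k → k < + 0 → g α β k ≡ + 0
  g-negative -[1+ _ ] _ = refl
  g-negative (+ _)    (+<+ ())

  g-recurrence : ∀ k → + 0 < k → g α β k ≡ g α β (k - + α) + g α β (k - + β)
  g-recurrence (+ zero)  (+<+ ())
  g-recurrence (+ suc m) _ =
    cong₂ _+_ (fuel-sufficient (suc m) _ (recursive-call-below 1≤α ℕP.≤-refl))
              (fuel-sufficient (suc m) _ (recursive-call-below 1≤β ℕP.≤-refl))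

  -- Below u = max(α,β) the longer step reaches a negative index, so only the
  -- shorter step ℓ = min(α,β) contributes.
  g-below-max : ∀ k → + 0 < k → k < + (α ⊔ β) → g α β k ≡ g α β (k - + (α ⊓ β))
  g-below-max k 0<k k<u with ℕP.≤-total α β
  ... | inj₁ α≤β = begin
      g α β k                                 ≡⟨ g-recurrence k 0<k ⟩
      g α β (k - + α) + g α β (k - + β)       ≡⟨ cong (λ x → g α β (k - + α) + x) (g-negative _ (sub-larger-negative k<β)) ⟩
      g α β (k - + α) + + 0                   ≡⟨ ℤP.+-identityʳ _ ⟩
      g α β (k - + α)                         ≡⟨ cong (λ l → g α β (k - + l)) (sym (ℕP.m≤n⇒m⊓n≡m α≤β)) ⟩
      g α β (k - + (α ⊓ β))                   ∎
    where
      open ≡-Reasoning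
      k<β : k < + β
      k<β = subst (λ v → k < + v) (ℕP.m≤n⇒m⊔n≡n α≤β) k<u
  ... | inj₂ β≤α = begin
      g α β k                                 ≡⟨ g-recurrence k 0<k ⟩
      g α β (k - + α) + g α β (k - + β)       ≡⟨ cong (_+ g α β (k - + β)) (g-negative _ (sub-larger-negative k<α)) ⟩
      + 0 + g α β (k - + β)                   ≡⟨ ℤP.+-identityˡ _ ⟩
      g α β (k - + β)                         ≡⟨ cong (λ l → g α β (k - + l)) (sym (ℕP.m≥n⇒m⊓n≡n β≤α)) ⟩
      g α β (k - + (α ⊓ β))                   ∎
    where
      open ≡-Reasoning
      k<α : k < + α
      k<α = subst (λ v → k < + v) (ℕP.m≥n⇒m⊔n≡m β≤α) k<u

sum-zero : ∀ N h → (∀ i → 1 ℕ.≤ i → i ℕ.≤ N → h i ≡ + 0) → sumFrom1 N h ≡ + 0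
sum-zero zero    h h≡0 = refl
sum-zero (suc N) h h≡0 =
  cong₂ _+_ (sum-zero N h (λ i 1≤i i≤N → h≡0 i 1≤i (ℕP.m≤n⇒m≤1+n i≤N)))
            (h≡0 (suc N) (s≤s ℕ.z≤n) ℕP.≤-refl)

sum-additive : ∀ N h h₁ h₂ → (∀ i → 1 ℕ.≤ i → i ℕ.≤ N → h i ≡ h₁ i + h₂ i) →
  sumFrom1 N h ≡ sumFrom1 N h₁ + sumFrom1 N h₂
sum-additive zero    h h₁ h₂ split = refl
sum-additive (suc N) h h₁ h₂ split =
  trans (cong₂ _+_ (sum-additive N h h₁ h₂ (λ i 1≤i i≤N → split i 1≤i (ℕP.m≤n⇒m≤1+n i≤N)))
                   (split (suc N) (s≤s ℕ.z≤n) ℕP.≤-refl))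
        (interchange (sumFrom1 N h₁) (sumFrom1 N h₂) (h₁ (suc N)) (h₂ (suc N)))
  where
    interchange : ∀ (a b c d : ℤ) → (a + b) + (c + d) ≡ (a + c) + (b + d)
    interchange = solve-∀

window : (ℤ → ℤ) → ℕ → ℤ → ℤ
window f N k = sumFrom1 N (λ i → f (k + + 1 - + i))

window-slide : ∀ f N k → window f N (+ 1 + k) + f (+ 1 + k - + N) ≡ f (+ 1 + k) + window f N k
window-slide f zero k = begin
    + 0 + f (+ 1 + k - + 0)   ≡⟨ ℤP.+-identityˡ _ ⟩
    f (+ 1 + k - + 0)         ≡⟨ cong f (ℤP.+-identityʳ _) ⟩
    f (+ 1 + k)               ≡⟨ sym (ℤP.+-identityʳ _) ⟩
    f (+ 1 + k) + + 0         ∎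
  where open ≡-Reasoning
window-slide f (suc N) k = begin
    (window f N (+ 1 + k) + f (+ 1 + k + + 1 - + suc N)) + f (+ 1 + k - + suc N)
      ≡⟨ cong₂ (λ new old → (window f N (+ 1 + k) + f new) + f old)
               (sub-suc (+ 1 + k) (+ N)) (realign k (+ N)) ⟩
    (window f N (+ 1 + k) + f (+ 1 + k - + N)) + f (k + + 1 - + suc N)
      ≡⟨ cong (_+ f (k + + 1 - + suc N)) (window-slide f N k) ⟩
    (f (+ 1 + k) + window f N k) + f (k + + 1 - + suc N)
      ≡⟨ ℤP.+-assoc (f (+ 1 + k)) _ _ ⟩
    f (+ 1 + k) + window f (suc N) k ∎
  where
    open ≡-Reasoning
    realign : ∀ (k n : ℤ) → + 1 + k - (+ 1 + n) ≡ k + + 1 - (+ 1 + n)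
    realign = solve-∀

window-stable : ∀ f N k → f (+ 1 + k) ≡ f (+ 1 + k - + N) → window f N (+ 1 + k) ≡ window f N k
window-stable f N k same = ∙-cancelʳ (f (+ 1 + k - + N)) _ _ (begin
    window f N (+ 1 + k) + f (+ 1 + k - + N)   ≡⟨ window-slide f N k ⟩
    f (+ 1 + k) + window f N k                 ≡⟨ cong (_+ window f N k) same ⟩
    f (+ 1 + k - + N) + window f N k           ≡⟨ ℤP.+-comm (f (+ 1 + k - + N)) _ ⟩
    window f N k + f (+ 1 + k - + N)           ∎)
  where open ≡-Reasoning

module Claims (α β : ℕ) (1≤α : 1 ℕ.≤ α) (1≤β : 1 ℕ.≤ β) where
  open Sequence α β 1≤α 1≤β

  -- ℓ = min(α,β) is positive, so the oldest entry g(-ℓ) of the window at 0 vanishes.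
  1≤ℓ : 1 ℕ.≤ α ⊓ β
  1≤ℓ = ℕP.⊓-glb 1≤α 1≤β

  -- For k < 0 all indices k+1-i, i ≥ 1, are negative.
  G-negative : ∀ k → k < + 0 → G α β k ≡ + 0
  G-negative k k<0 = sum-zero (α ⊓ β) _ (λ i 1≤i _ →
    g-negative _ (ℤP.≤-<-trans (shifted-below k 1≤i) k<0))

  -- G(0) = 1: slide the window from k = -1, where G vanishes; the entry that
  -- leaves, g(-ℓ), is zero and the entry that enters is g(0) = 1.
  G-zero : G α β (+ 0) ≡ + 1
  G-zero = ∙-cancelʳ (+ 0) _ _ (begin
      G α β (+ 0) + + 0                                 ≡⟨ cong (λ x → G α β (+ 0) + x) (sym (g-negative _ oldest<0)) ⟩
      G α β (+ 0) + g α β (+ 0 - + (α ⊓ β))             ≡⟨ window-slide (g α β) (α ⊓ β) -[1+ 0 ] ⟩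
      + 1 + G α β -[1+ 0 ]                              ≡⟨ cong (λ x → + 1 + x) (G-negative -[1+ 0 ] -<+) ⟩
      + 1 + + 0                                         ∎)
    where
      open ≡-Reasoning
      oldest<0 : + 0 - + (α ⊓ β) < + 0
      oldest<0 = sub-larger-negative (+<+ 1≤ℓ)

  -- For 0 < k < u the window at k equals the window at k-1 by g-below-max.
  G-initial : ∀ n → n ℕ.< α ⊔ β → G α β (+ n) ≡ + 1
  G-initial zero    _   = G-zero
  G-initial (suc n) n<u =
    trans (window-stable (g α β) (α ⊓ β) (+ n) (g-below-max (+ suc n) (+<+ (s≤s ℕ.z≤n)) (+<+ n<u)))
          (G-initial n (ℕP.<-trans (ℕP.n<1+n n) n<u))

  -- For k ≥ u ≥ ℓ each summand g(k+1-i) has positive index and splits by the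
  -- recurrence for g into the corresponding summands of G(k-α) and G(k-β).
  G-recurrence : ∀ k → + (α ⊔ β) ≤ k → G α β k ≡ G α β (k - + α) + G α β (k - + β)
  G-recurrence k u≤k = sum-additive (α ⊓ β) _ _ _ summand
    where
      regroup : ∀ (k i a : ℤ) → k + + 1 - i - a ≡ k - a + + 1 - i
      regroup = solve-∀
      summand : ∀ i → 1 ℕ.≤ i → i ℕ.≤ α ⊓ β →
        g α β (k + + 1 - + i) ≡ g α β (k - + α + + 1 - + i) + g α β (k - + β + + 1 - + i)
      summand i _ i≤ℓ =
        trans (g-recurrence _ (shifted-positive i≤k))
              (cong₂ _+_ (cong (g α β) (regroup k (+ i) (+ α))) (cong (g α β) (regroup k (+ i) (+ β))))
        where
          i≤k : + i ≤ k
          i≤k = ℤP.≤-trans (+≤+ (ℕP.≤-trans i≤ℓ (ℕP.m⊓n≤m⊔n α β))) u≤k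

proposition1 : (α β : ℕ) → 1 ℕ.≤ α → 1 ℕ.≤ β →
    ((k : ℤ) → k < + 0 → G α β k ≡ + 0)
    × ((k : ℤ) → + 0 ≤ k → k < + (α ⊔ β) → G α β k ≡ + 1)
    × ((k : ℤ) → + (α ⊔ β) ≤ k → G α β k ≡ G α β (k - + α) + G α β (k - + β))
proposition1 α β 1≤α 1≤β = G-negative , initial , G-recurrence
  where
    open Claims α β 1≤α 1≤β
    initial : (k : ℤ) → + 0 ≤ k → k < + (α ⊔ β) → G α β k ≡ + 1
    initial (+ n) _ (+<+ n<u) = G-initial n n<u
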